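{- Let $k$ be an integer and $n$ a positive integer. In each of the following cases, $\mathrm{CP}(k,n)$ is not Hamiltonian: (i) $n$ is odd and $k$ is even; (ii) $n$ is even and either $\varphi(n)\mid k$ or $\varphi(n)\mid k+n-1$.
   Context: For an integer $k$ and a positive integer $n$, $\mathrm{CP}(k,n)$ is the simple graph with vertex set $\{k,k+1,\ldots,k+n-1\}$ in which two distinct vertices $a,b$ are adjacent if and only if $\gcd(a,b)=1$ (with $\gcd(a,0)=|a|$). For a positive integer $n$, $\varphi(n)$ denotes the product of all odd primes less than $n$ (the empty product being $1$). A graph is Hamiltonian if it contains a cycle through every vertex exactly once. -}

module Defs where

open import Data.Nat as ℕ using (ℕ; zero; suc; _≤_; _%_)
open import Data.Nat.Primality using (prime?)
open import Data.Integer as ℤ using (ℤ; +_; 1ℤ)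
open import Data.Integer.GCD using (gcd)
open import Data.Fin using (Fin; toℕ)
open import Data.Bool using (if_then_else_; _∧_)
open import Data.Product using (Σ; _×_)
open import Data.Sum using (_⊎_)
open import Relation.Nullary using (¬_; does)
open import Relation.Binary.PropositionalEquality using (_≡_)
open import Function.Definitions using (Bijective)

-- CP(k,n): vertex i : Fin n stands for the integer k + i; distinct vertices
-- a, b are adjacent iff gcd(a,b) = 1 (stdlib gcd: gcd i j = gcd |i| |j|,
-- so gcd(a,0) = |a|).
CPAdj : ℤ → (n : ℕ) → Fin n → Fin n → Set
CPAdj k n i j = (¬ i ≡ j) × gcd (k ℤ.+ + toℕ i) (k ℤ.+ + toℕ j) ≡ 1ℤ

-- Hamiltonian: there is a cycle through every vertex exactly once, i.e.
-- (simple graph, so a cycle has at least 3 vertices) n ≥ 3 and a cyclic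
-- ordering σ(0), σ(1), …, σ(n-1) of all vertices (σ a bijection) with
-- σ(i) adjacent to σ(i+1) for i < n-1, and σ(n-1) adjacent to σ(0).
Hamiltonian : (n : ℕ) → (Fin n → Fin n → Set) → Set
Hamiltonian n Adj =
  3 ≤ n ×
  Σ (Fin n → Fin n) λ σ →
    Bijective _≡_ _≡_ σ ×
    (∀ (i j : Fin n) →
       (toℕ j ≡ suc (toℕ i) ⊎ (toℕ i ≡ n ℕ.∸ 1 × toℕ j ≡ 0)) →
       Adj (σ i) (σ j))

oddPrimeOr1 : ℕ → ℕ
oddPrimeOr1 m = if does (prime? m) ∧ does (m % 2 ℕ.≟ 1) then m else 1

-- φ(n) = product of all odd primes less than n (empty product = 1)
φ : ℕ → ℕ
φ zero = 1
φ (suc m) = φ m ℕ.* oddPrimeOr1 m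

module Submission where

-- Along a Hamiltonian cycle of CP(k,n) consecutive vertices are
-- coprime, so no two even vertices are consecutive: mapping each even vertex to
-- its successor on the cycle injects the even vertices into the odd ones.
-- (i)  If n is odd and k even, the range k, …, k+n-1 has one more even than
--      odd vertex, so no such injection exists.
-- (ii) If n is even, the counts agree, so no two odd vertices can be
--      consecutive either.  Let c ∈ {k, k+n-1} with φ(n) ∣ c.  A cycle-neighbour
--      x of c is coprime to c; if |x - c| were odd and > 1, an odd prime factor
--      of it is < n, divides φ(n), hence c, hence x.  So x is either the unique
--      integer neighbour of the endpoint c, or x and c have the same parity and
--      are both odd.  Both cycle-neighbours cannot be the unique integer
--      neighbour (the cycle has length ≥ 3), so c lies on an odd–odd edge.

open import Defs
open import Data.Nat using (ℕ; NonZero)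
open import Data.Nat.Divisibility as ℕD using ()
open import Data.Integer using (ℤ; +_; _+_; _-_)
open import Data.Integer.Divisibility using (_∣_)
open import Data.Product using (_×_)
open import Data.Sum using (_⊎_)
open import Relation.Nullary using (¬_)

import Data.Nat as ℕ
open import Data.Nat using (zero; suc; _≤_; _<_; s≤s; _<?_; ≢-nonZero; nonTrivial⇒≢1)
open import Data.Nat.Properties
  using ( ≤-total; ≤-antisym; ≤-pred; ≮⇒≥; ≤-trans; ≤-reflexive; <-≤-trans; ≤-<-trans; <-irrefl; 1+n≰n
        ; m<1+n⇒m<n∨m≡n; suc-injective; m∸n≤m; m+[n∸m]≡n; +-comm; *-comm
        ; +-monoˡ-≤; +-monoʳ-≤; +-monoʳ-<; *-monoʳ-≤; +-cancelˡ-≡; +-cancelʳ-≡; *-cancelˡ-≡; *-cancelʳ-<)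
open import Data.Nat.DivMod using (m≡m%n+[m/n]*n; m%n<n)
open import Data.Nat.ListAction using (product)
open import Data.Nat.Primality using (Prime; prime?; prime⇒nonTrivial)
open import Data.Nat.Primality.Factorisation using (factorise)
open import Data.Nat.Tactic.RingSolver renaming (solve-∀ to ℕ-solve)
import Data.Integer.Properties as ℤ
open import Data.Integer using (_*_)
open import Data.Integer.DivMod using (_/ℕ_; _%ℕ_; a≡a%ℕn+[a/ℕn]*n; n%ℕd<d)
open import Data.Integer.Divisibility.Signed using (∣ᵤ⇒∣; ∣⇒∣ᵤ; ∣m∣n⇒∣m+n; ∣m+n∣n⇒∣m; ∣n⇒∣m*n; ∣-refl)
open import Data.Integer.GCD using (gcd; gcd-greatest; gcd-comm)
open import Data.Integer.Tactic.RingSolver renaming (solve-∀ to ℤ-solve)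
open import Data.Fin using (Fin; toℕ; fromℕ<; fromℕ; inject₁) renaming (zero to fzero; suc to fsuc)
open import Data.Fin.Properties using (toℕ<n; toℕ-fromℕ<; toℕ-fromℕ; toℕ-inject₁; toℕ-injective; injective⇒≤)
open import Data.Vec.Functional using () renaming (_∷_ to _∷ᵥ_)
open import Data.List using ([]; _∷_)
open import Data.List.Relation.Unary.All using (_∷_)
open import Data.Bool using (if_then_else_; _∧_)
open import Data.Product using (∃; _,_; proj₁; proj₂)
open import Data.Sum using (inj₁; inj₂)
open import Data.Empty using (⊥; ⊥-elim)
open import Relation.Nullary using (yes; no; contradiction)
open import Relation.Nullary.Decidable using (dec-true)
open import Relation.Binary.PropositionalEquality
  using (_≡_; _≢_; refl; sym; trans; cong; cong₂; subst; module ≡-Reasoning)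
open import Function using (_∘_)
open import Function.Definitions using (Injective; Bijective)

Succ : (n : ℕ) → Fin n → Fin n → Set
Succ n i j = toℕ j ≡ suc (toℕ i) ⊎ (toℕ i ≡ n ℕ.∸ 1 × toℕ j ≡ 0)

successor : ∀ {n} (i : Fin n) → ∃ (Succ n i)
successor {suc n} i with suc (toℕ i) <? suc n
... | yes i+1<n = fromℕ< i+1<n , inj₁ (toℕ-fromℕ< i+1<n)
... | no  i+1≮n = fzero , inj₂ (≤-antisym (≤-pred (toℕ<n i)) (≤-pred (≮⇒≥ i+1≮n)) , refl)

predecessor : ∀ {n} (j : Fin n) → ∃ λ i → Succ n i j
predecessor {suc n} fzero    = fromℕ n , inj₂ (toℕ-fromℕ n , refl)
predecessor {suc n} (fsuc j) = inject₁ j , inj₁ (cong suc (sym (toℕ-inject₁ j)))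

Succ-injectiveˡ : ∀ {n i i' j} → Succ n i j → Succ n i' j → i ≡ i'
Succ-injectiveˡ (inj₁ j≡1+i) (inj₁ j≡1+i') = toℕ-injective (suc-injective (trans (sym j≡1+i) j≡1+i'))
Succ-injectiveˡ (inj₁ j≡1+i) (inj₂ (_ , j≡0)) = contradiction (trans (sym j≡1+i) j≡0) λ ()
Succ-injectiveˡ (inj₂ (_ , j≡0)) (inj₁ j≡1+i') = contradiction (trans (sym j≡1+i') j≡0) λ ()
Succ-injectiveˡ (inj₂ (i≡n-1 , _)) (inj₂ (i'≡n-1 , _)) = toℕ-injective (trans i≡n-1 (sym i'≡n-1))

Succ-no-2-cycle : ∀ {n i j} → 3 ≤ n → Succ n i j → Succ n j i → ⊥
Succ-no-2-cycle {i = i} _ (inj₁ j≡1+i) (inj₁ i≡1+j) = n≢2+n (toℕ i) (trans i≡1+j (cong suc j≡1+i))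
  where
  n≢2+n : ∀ m → m ≢ suc (suc m)
  n≢2+n (suc m) eq = n≢2+n m (suc-injective eq)
Succ-no-2-cycle (s≤s (s≤s (s≤s _))) (inj₁ j≡1+i) (inj₂ (j≡n-1 , i≡0)) =
  contradiction (trans (sym j≡n-1) (trans j≡1+i (cong suc i≡0))) λ ()
Succ-no-2-cycle (s≤s (s≤s (s≤s _))) (inj₂ (i≡n-1 , j≡0)) (inj₁ i≡1+j) =
  contradiction (trans (sym i≡n-1) (trans i≡1+j (cong suc j≡0))) λ ()
Succ-no-2-cycle (s≤s (s≤s (s≤s _))) (inj₂ (i≡n-1 , _)) (inj₂ (_ , i≡0)) =
  contradiction (trans (sym i≡n-1) i≡0) λ ()

module Ordering {n : ℕ} (σ : Fin n → Fin n) (σ-bijective : Bijective _≡_ _≡_ σ) where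

  σ-injective : Injective _≡_ _≡_ σ
  σ-injective = proj₁ σ-bijective

  σ⁻¹ : Fin n → Fin n
  σ⁻¹ v = proj₁ (proj₂ σ-bijective v)

  σ∘σ⁻¹ : ∀ v → σ (σ⁻¹ v) ≡ v
  σ∘σ⁻¹ v = proj₂ (proj₂ σ-bijective v) refl

-- Let σ list the vertices of Fin n in
-- cyclic order and let P be a property of vertices no two cyclically
-- consecutive vertices share.  Then the successor of a P-vertex is a ¬P-vertex,
-- distinct P-vertices have distinct successors, and so (given an injective
-- coding of the ¬P-vertices into Fin m) there are at most m P-vertices —
-- and at most m - 1 if moreover some ¬P-vertex is followed by a ¬P-vertex.
module CycleCounting {n : ℕ} (σ : Fin n → Fin n) (σ-bijective : Bijective _≡_ _≡_ σ)
  (P : Fin n → Set) (no-P-edge : ∀ {i j} → Succ n i j → P (σ i) → ¬ P (σ j))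
  {m : ℕ} (code : ∀ v → ¬ P v → Fin m)
  (code-injective : ∀ {v w} (¬pv : ¬ P v) (¬pw : ¬ P w) → code v ¬pv ≡ code w ¬pw → v ≡ w)
  where

  open Ordering σ σ-bijective

  ¬P-heads-bound : ∀ {A} (g h : Fin A → Fin n) → Injective _≡_ _≡_ g →
    (∀ t → Succ n (g t) (h t)) → (∀ t → ¬ P (σ (h t))) → A ≤ m
  ¬P-heads-bound g h g-injective edge ¬P-head = injective⇒≤ λ {t} {t'} same-code →
    let same-head = σ-injective (code-injective (¬P-head t) (¬P-head t') same-code)
    in g-injective (Succ-injectiveˡ (edge t) (subst (Succ n (g t')) (sym same-head) (edge t')))

  module _ {A : ℕ} (e : Fin A → Fin n) (e-injective : Injective _≡_ _≡_ e) (e-P : ∀ t → P (e t)) where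

    position : Fin A → Fin n
    position t = σ⁻¹ (e t)

    position-injective : Injective _≡_ _≡_ position
    position-injective {t} {t'} eq =
      e-injective (trans (sym (σ∘σ⁻¹ (e t))) (trans (cong σ eq) (σ∘σ⁻¹ (e t'))))

    position-P : ∀ t → P (σ (position t))
    position-P t = subst P (sym (σ∘σ⁻¹ (e t))) (e-P t)

    next : Fin A → Fin n
    next t = proj₁ (successor (position t))

    next-¬P : ∀ t → ¬ P (σ (next t))
    next-¬P t = no-P-edge (proj₂ (successor (position t))) (position-P t)

    P-count-≤ : A ≤ m
    P-count-≤ = ¬P-heads-bound position next position-injective (λ t → proj₂ (successor (position t))) next-¬P

    -- An edge i → j between two ¬P-vertices is an extra edge with a ¬P head.
    P-count-< : ∀ {i j} → Succ n i j → ¬ P (σ i) → ¬ P (σ j) → suc A ≤ m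
    P-count-< {i} {j} i→j ¬P-i ¬P-j =
      ¬P-heads-bound (i ∷ᵥ position) (j ∷ᵥ next) tails-injective edges heads
      where
      i≢position : ∀ t → i ≢ position t
      i≢position t i≡pt = ¬P-i (subst (λ v → P (σ v)) (sym i≡pt) (position-P t))

      tails-injective : Injective _≡_ _≡_ (i ∷ᵥ position)
      tails-injective {fzero}  {fzero}   _  = refl
      tails-injective {fzero}  {fsuc t'} eq = ⊥-elim (i≢position t' eq)
      tails-injective {fsuc t} {fzero}   eq = ⊥-elim (i≢position t (sym eq))
      tails-injective {fsuc t} {fsuc t'} eq = cong fsuc (position-injective eq)

      edges : ∀ t → Succ n ((i ∷ᵥ position) t) ((j ∷ᵥ next) t)
      edges fzero    = i→j
      edges (fsuc t) = proj₂ (successor (position t))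

      heads : ∀ t → ¬ P (σ ((j ∷ᵥ next) t))
      heads fzero    = ¬P-j
      heads (fsuc t) = next-¬P t

∣-+ : ∀ {a x y} → a ∣ x → a ∣ y → a ∣ x + y
∣-+ {a} {x} {y} a∣x a∣y = ∣⇒∣ᵤ (∣m∣n⇒∣m+n (∣ᵤ⇒∣ {a} {x} a∣x) (∣ᵤ⇒∣ {a} {y} a∣y))

∣-+-cancel : ∀ {a x y} → a ∣ x + y → a ∣ y → a ∣ x
∣-+-cancel {a} {x} {y} a∣x+y a∣y =
  ∣⇒∣ᵤ {a} {x} (∣m+n∣n⇒∣m (∣ᵤ⇒∣ {a} {x + y} a∣x+y) (∣ᵤ⇒∣ {a} {y} a∣y))

parity-offset : ∀ k → ∃ λ r → r ≤ 1 × (+ 2) ∣ k + + r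
parity-offset k =
  r , ≤-pred (n%ℕd<d k 2) , subst (+ 2 ∣_) (sym k+r≡[q+r]*2) (∣⇒∣ᵤ (∣n⇒∣m*n (q + + r) ∣-refl))
  where
  r : ℕ
  r = k %ℕ 2
  q : ℤ
  q = k /ℕ 2
  k+r≡[q+r]*2 : k + + r ≡ (q + + r) * + 2
  k+r≡[q+r]*2 = trans (cong (_+ + r) (a≡a%ℕn+[a/ℕn]*n k 2)) (rearrange (+ r) q)
    where
    rearrange : ∀ a b → (a + b * + 2) + a ≡ (b + a) * + 2
    rearrange = ℤ-solve

odd⇒%2≡1 : ∀ {u} → ¬ 2 ℕD.∣ u → u ℕ.% 2 ≡ 1
odd⇒%2≡1 {u} u-odd = remainder≡1 (u ℕ.% 2) (m%n<n u 2) (u-odd ∘ ℕD.m%n≡0⇒n∣m u 2)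
  where
  remainder≡1 : ∀ ρ → ρ < 2 → ρ ≢ 0 → ρ ≡ 1
  remainder≡1 zero          _                   ρ≢0 = ⊥-elim (ρ≢0 refl)
  remainder≡1 (suc zero)    _                   _   = refl
  remainder≡1 (suc (suc _)) (s≤s (s≤s ())) _

odd-split : ∀ u → ¬ 2 ℕD.∣ u → u ≡ suc (u ℕ./ 2 ℕ.* 2)
odd-split u u-odd = trans (m≡m%n+[m/n]*n u 2) (cong (ℕ._+ u ℕ./ 2 ℕ.* 2) (odd⇒%2≡1 u-odd))

EvenAt : ℤ → ℕ → Set
EvenAt k v = (+ 2) ∣ k + + v

-- If
-- 2A + r ≤ n + 1 there are at least A even vertices (k + r, k + r + 2, …),
-- and if r + n ≤ 2m + 1 the odd vertices have distinct codes (r + v)/2 < m.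
module VertexParity (k : ℤ) (n : ℕ) {r : ℕ} (k+r-even : EvenAt k r) where

  even-by-offset : ∀ v → 2 ℕD.∣ r ℕ.+ v → EvenAt k v
  even-by-offset v 2∣r+v = ∣-+-cancel {+ 2} {k + + v} {+ (r ℕ.+ r)} 2∣[k+v]+[r+r] 2∣r+r
    where
    regroup-sum : (k + + r) + + (r ℕ.+ v) ≡ (k + + v) + + (r ℕ.+ r)
    regroup-sum = trans (cong (λ z → (k + + r) + z) (ℤ.pos-+ r v))
                  (trans (regroup k (+ r) (+ v)) (cong (λ z → (k + + v) + z) (sym (ℤ.pos-+ r r))))
      where
      regroup : ∀ a b c → (a + b) + (b + c) ≡ (a + c) + (b + b)
      regroup = ℤ-solve
    2∣[k+v]+[r+r] : + 2 ∣ (k + + v) + + (r ℕ.+ r)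
    2∣[k+v]+[r+r] = subst (+ 2 ∣_) regroup-sum (∣-+ {+ 2} {k + + r} {+ (r ℕ.+ v)} k+r-even 2∣r+v)
    2∣r+r : 2 ℕD.∣ r ℕ.+ r
    2∣r+r = ℕD.divides r (double r)
      where
      double : ∀ a → a ℕ.+ a ≡ a ℕ.* 2
      double = ℕ-solve

  module _ {A : ℕ} (room : 2 ℕ.* A ℕ.+ r ≤ suc n) where

    evenVertex-< : (t : Fin A) → 2 ℕ.* toℕ t ℕ.+ r < n
    evenVertex-< t =
      ≤-pred (subst (_≤ suc n) (step (toℕ t) r) (≤-trans (+-monoˡ-≤ r (*-monoʳ-≤ 2 (toℕ<n t))) room))
      where
      step : ∀ a b → 2 ℕ.* suc a ℕ.+ b ≡ suc (suc (2 ℕ.* a ℕ.+ b))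
      step = ℕ-solve

    evenVertex : Fin A → Fin n
    evenVertex t = fromℕ< (evenVertex-< t)

    evenVertex-even : ∀ t → EvenAt k (toℕ (evenVertex t))
    evenVertex-even t = subst (EvenAt k) (sym (toℕ-fromℕ< (evenVertex-< t)))
      (even-by-offset _ (ℕD.divides (toℕ t ℕ.+ r) (pair (toℕ t) r)))
      where
      pair : ∀ a b → b ℕ.+ (2 ℕ.* a ℕ.+ b) ≡ (a ℕ.+ b) ℕ.* 2
      pair = ℕ-solve

    evenVertex-injective : Injective _≡_ _≡_ evenVertex
    evenVertex-injective {t} {t'} eq =
      toℕ-injective (*-cancelˡ-≡ (toℕ t) (toℕ t') 2 (+-cancelʳ-≡ r _ _
        (trans (sym (toℕ-fromℕ< (evenVertex-< t))) (trans (cong toℕ eq) (toℕ-fromℕ< (evenVertex-< t'))))))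

  module _ {m : ℕ} (room : r ℕ.+ n ≤ suc (2 ℕ.* m)) where

    odd-offset : (v : Fin n) → ¬ EvenAt k (toℕ v) → r ℕ.+ toℕ v ≡ suc ((r ℕ.+ toℕ v) ℕ./ 2 ℕ.* 2)
    odd-offset v odd = odd-split (r ℕ.+ toℕ v) (odd ∘ even-by-offset (toℕ v))

    oddCode-< : (v : Fin n) → ¬ EvenAt k (toℕ v) → (r ℕ.+ toℕ v) ℕ./ 2 < m
    oddCode-< v odd = *-cancelʳ-< 2 _ m (≤-pred (subst (_≤ suc (m ℕ.* 2)) (cong suc (odd-offset v odd))
      (<-≤-trans (+-monoʳ-< r (toℕ<n v)) (subst (r ℕ.+ n ≤_) (cong suc (*-comm 2 m)) room))))

    oddCode : (v : Fin n) → ¬ EvenAt k (toℕ v) → Fin m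
    oddCode v odd = fromℕ< (oddCode-< v odd)

    oddCode-injective : ∀ {v w} (odd-v : ¬ EvenAt k (toℕ v)) (odd-w : ¬ EvenAt k (toℕ w)) →
      oddCode v odd-v ≡ oddCode w odd-w → v ≡ w
    oddCode-injective {v} {w} odd-v odd-w eq = toℕ-injective (+-cancelˡ-≡ r _ _ (begin
      r ℕ.+ toℕ v                           ≡⟨ odd-offset v odd-v ⟩
      suc ((r ℕ.+ toℕ v) ℕ./ 2 ℕ.* 2)      ≡⟨ cong (λ h → suc (h ℕ.* 2)) same-half ⟩
      suc ((r ℕ.+ toℕ w) ℕ./ 2 ℕ.* 2)      ≡⟨ sym (odd-offset w odd-w) ⟩
      r ℕ.+ toℕ w                           ∎))
      where
      open ≡-Reasoning
      same-half : (r ℕ.+ toℕ v) ℕ./ 2 ≡ (r ℕ.+ toℕ w) ℕ./ 2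
      same-half = trans (sym (toℕ-fromℕ< (oddCode-< v odd-v)))
                        (trans (cong toℕ eq) (toℕ-fromℕ< (oddCode-< w odd-w)))

common-factor⇒¬coprime : ∀ {q} a b → q ≢ 1 → + q ∣ a → + q ∣ b → gcd a b ≢ + 1
common-factor⇒¬coprime {q} a b q≢1 q∣a q∣b gcd≡1 =
  q≢1 (ℕD.∣1⇒≡1 (subst (+ q ∣_) gcd≡1 (gcd-greatest {a} {b} {+ q} q∣a q∣b)))

oddPrimeOr1-oddPrime : ∀ {q} → Prime q → ¬ 2 ℕD.∣ q → oddPrimeOr1 q ≡ q
oddPrimeOr1-oddPrime {q} q-prime q-odd =
  cong₂ (λ a b → if a ∧ b then q else 1)
        (dec-true (prime? q) q-prime) (dec-true (q ℕ.% 2 ℕ.≟ 1) (odd⇒%2≡1 q-odd))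

oddPrime∣φ : ∀ {q} n → Prime q → ¬ 2 ℕD.∣ q → q < n → q ℕD.∣ φ n
oddPrime∣φ {q} (suc n) q-prime q-odd q<1+n with m<1+n⇒m<n∨m≡n q<1+n
... | inj₁ q<n  = ℕD.∣m⇒∣m*n (oddPrimeOr1 n) (oddPrime∣φ n q-prime q-odd q<n)
... | inj₂ refl =
  subst (q ℕD.∣_) (cong (φ q ℕ.*_) (sym (oddPrimeOr1-oddPrime q-prime q-odd))) (ℕD.n∣m*n (φ q))

oddPrimeFactor : ∀ d → ¬ 2 ℕD.∣ d → d ≢ 1 → ∃ λ q → Prime q × ¬ 2 ℕD.∣ q × q ℕD.∣ d
oddPrimeFactor zero          d-odd _   = ⊥-elim (d-odd (2 ℕD.∣0))
oddPrimeFactor (suc zero)    _     d≢1 = ⊥-elim (d≢1 refl)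
oddPrimeFactor (suc (suc d)) d-odd _ with factorise (suc (suc d))
... | record { factors = [] ; isFactorisation = () }
... | record { factors = q ∷ qs ; isFactorisation = d≡Πqs ; factorsPrime = q-prime ∷ _ } =
  q , q-prime , (λ 2∣q → d-odd (ℕD.∣-trans 2∣q q∣d)) , q∣d
  where
  q∣d : q ℕD.∣ suc (suc d)
  q∣d = ℕD.divides (product qs) (trans d≡Πqs (*-comm q (product qs)))

Apart : ℕ → ℕ → ℕ → Set
Apart d x y = x ≡ y ℕ.+ d ⊎ y ≡ x ℕ.+ d

Apart-sym : ∀ {d x y} → Apart d x y → Apart d y x
Apart-sym (inj₁ x≡y+d) = inj₂ x≡y+d
Apart-sym (inj₂ y≡x+d) = inj₁ y≡x+d

distance : ∀ {n x y} → x < n → y < n → ∃ λ d → d < n × Apart d x y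
distance {x = x} {y} x<n y<n with ≤-total x y
... | inj₁ x≤y = y ℕ.∸ x , ≤-<-trans (m∸n≤m y x) y<n , inj₂ (sym (m+[n∸m]≡n x≤y))
... | inj₂ y≤x = x ℕ.∸ y , ≤-<-trans (m∸n≤m x y) x<n , inj₁ (sym (m+[n∸m]≡n y≤x))

vertex-shift : ∀ k a b → (k + + a) + + b ≡ k + + (a ℕ.+ b)
vertex-shift k a b = trans (ℤ.+-assoc k (+ a) (+ b)) (cong (λ z → k + z) (sym (ℤ.pos-+ a b)))

∣-across : ∀ {q d x y} k → + q ∣ + d → Apart d x y → + q ∣ k + + y → + q ∣ k + + x
∣-across {q} {d} {x} {y} k q∣d (inj₁ refl) q∣y =
  subst (+ q ∣_) (vertex-shift k y d) (∣-+ {+ q} {k + + y} {+ d} q∣y q∣d)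
∣-across {q} {d} {x} {y} k q∣d (inj₂ refl) q∣y =
  ∣-+-cancel {+ q} {k + + x} {+ d} (subst (+ q ∣_) (sym (vertex-shift k x d)) q∣y) q∣d

endpoint-neighbour-unique : ∀ {n x x' y} → (y ≡ 0 ⊎ suc y ≡ n) → x < n → x' < n →
  Apart 1 x y → Apart 1 x' y → x ≡ x'
endpoint-neighbour-unique _     _   _    (inj₁ x≡y+1) (inj₁ x'≡y+1) = trans x≡y+1 (sym x'≡y+1)
endpoint-neighbour-unique _     _   _    (inj₂ y≡x+1) (inj₂ y≡x'+1) =
  +-cancelʳ-≡ 1 _ _ (trans (sym y≡x+1) y≡x'+1)
endpoint-neighbour-unique y-end x<n _    (inj₁ x≡y+1) (inj₂ y≡x'+1) =
  ⊥-elim (two-sided y-end x<n x≡y+1 y≡x'+1)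
  where
  two-sided : ∀ {n x x' y} → (y ≡ 0 ⊎ suc y ≡ n) → x < n → x ≡ y ℕ.+ 1 → y ≡ x' ℕ.+ 1 → ⊥
  two-sided {x' = x'} (inj₁ y≡0)   _   _     y≡x'+1 =
    contradiction (trans (sym y≡0) (trans y≡x'+1 (+-comm x' 1))) λ ()
  two-sided {y = y}   (inj₂ 1+y≡n) x<n x≡y+1 _      =
    <-irrefl (trans x≡y+1 (trans (+-comm y 1) 1+y≡n)) x<n
endpoint-neighbour-unique y-end x<n x'<n (inj₂ y≡x+1) (inj₁ x'≡y+1) =
  sym (endpoint-neighbour-unique y-end x'<n x<n (inj₁ x'≡y+1) (inj₂ y≡x+1))

-- Write d < n for their distance:
-- an even d gives k + x and k + y the same parity (and they cannot both be
-- even), while an odd d ≠ 1 has an odd prime factor q < n, which divides φ(n)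
-- and hence both vertices.
coprime-to-φ-multiple : ∀ k {n x y} → + φ n ∣ k + + y → x < n → y < n →
  gcd (k + + y) (k + + x) ≡ + 1 → Apart 1 x y ⊎ (¬ EvenAt k y × ¬ EvenAt k x)
coprime-to-φ-multiple k {n} {x} {y} φ∣y x<n y<n coprime with distance x<n y<n
... | d , d<n , apart with 2 ℕD.∣? d
...   | yes 2∣d = inj₂ (y-odd , x-odd)
  where
  y-odd : ¬ EvenAt k y
  y-odd y-even = common-factor⇒¬coprime (k + + y) (k + + x) (λ ()) y-even (∣-across k 2∣d apart y-even) coprime
  x-odd : ¬ EvenAt k x
  x-odd x-even = y-odd (∣-across k 2∣d (Apart-sym apart) x-even)
...   | no d-odd with d ℕ.≟ 1
...     | yes refl = inj₁ apart
...     | no d≢1 with oddPrimeFactor d d-odd d≢1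
...       | q , q-prime , q-odd , q∣d =
  ⊥-elim (common-factor⇒¬coprime (k + + y) (k + + x) (nonTrivial⇒≢1 {{prime⇒nonTrivial q-prime}})
                                 q∣y (∣-across k q∣d apart q∣y) coprime)
  where
  d≢0 : d ≢ 0
  d≢0 refl = d-odd (2 ℕD.∣0)
  q<n : q < n
  q<n = ≤-<-trans (ℕD.∣⇒≤ {{≢-nonZero d≢0}} q∣d) d<n
  q∣y : + q ∣ k + + y
  q∣y = ℕD.∣-trans (oddPrime∣φ n q-prime q-odd q<n) φ∣y

module HamiltonianCycle (k : ℤ) (n : ℕ) (σ : Fin n → Fin n) (σ-bijective : Bijective _≡_ _≡_ σ)
  (adjacent : ∀ i j → Succ n i j → CPAdj k n (σ i) (σ j)) where

  open Ordering σ σ-bijective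

  Even : Fin n → Set
  Even v = EvenAt k (toℕ v)

  coprime-edge : ∀ {i j} → Succ n i j → gcd (k + + toℕ (σ i)) (k + + toℕ (σ j)) ≡ + 1
  coprime-edge {i} {j} i→j = proj₂ (adjacent i j i→j)

  no-even-edge : ∀ {i j} → Succ n i j → Even (σ i) → ¬ Even (σ j)
  no-even-edge {i} {j} i→j even-i even-j =
    common-factor⇒¬coprime (k + + toℕ (σ i)) (k + + toℕ (σ j)) (λ ()) even-i even-j (coprime-edge i→j)

  module Count {r : ℕ} (k+r-even : EvenAt k r) {A m : ℕ}
               (room-even : 2 ℕ.* A ℕ.+ r ≤ suc n) (room-odd : r ℕ.+ n ≤ suc (2 ℕ.* m)) where
    open VertexParity k n k+r-even
    open CycleCounting σ σ-bijective Even no-even-edge {m} (oddCode room-odd) (oddCode-injective room-odd)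

    evens-≤-odds : A ≤ m
    evens-≤-odds = P-count-≤ (evenVertex room-even) (evenVertex-injective room-even) (evenVertex-even room-even)

    odd-edge⇒evens-<-odds : ∀ {i j} → Succ n i j → ¬ Even (σ i) → ¬ Even (σ j) → suc A ≤ m
    odd-edge⇒evens-<-odds =
      P-count-< (evenVertex room-even) (evenVertex-injective room-even) (evenVertex-even room-even)

  -- Case (i): for odd n = 2m + 1 and even k there are m + 1 even vertices
  -- (k, k + 2, …, k + 2m) but only m odd ones.
  odd-order-even-start : ¬ 2 ℕD.∣ n → + 2 ∣ k → ⊥
  odd-order-even-start n-odd 2∣k = 1+n≰n evens-≤-odds
    where
    m : ℕ
    m = n ℕ./ 2
    n≡2m+1 : n ≡ suc (m ℕ.* 2)
    n≡2m+1 = odd-split n n-odd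
    room-even : 2 ℕ.* suc m ℕ.+ 0 ≤ suc n
    room-even = ≤-reflexive (trans (double m) (cong suc (sym n≡2m+1)))
      where
      double : ∀ a → 2 ℕ.* suc a ℕ.+ 0 ≡ suc (suc (a ℕ.* 2))
      double = ℕ-solve
    room-odd : 0 ℕ.+ n ≤ suc (2 ℕ.* m)
    room-odd = ≤-reflexive (trans n≡2m+1 (cong suc (*-comm m 2)))
    open Count {r = 0} (subst (+ 2 ∣_) (sym (ℤ.+-identityʳ k)) 2∣k) {suc m} {m} room-even room-odd

  -- For even n = 2m there are m even and m odd vertices, so no two odd
  -- vertices can be consecutive.
  even-order-no-odd-edge : 2 ℕD.∣ n → ∀ {i j} → Succ n i j → ¬ Even (σ i) → ¬ Even (σ j) → ⊥
  even-order-no-odd-edge (ℕD.divides m n≡m*2) i→j odd-i odd-j =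
    1+n≰n (odd-edge⇒evens-<-odds i→j odd-i odd-j)
    where
    r : ℕ
    r = proj₁ (parity-offset k)
    r≤1 : r ≤ 1
    r≤1 = proj₁ (proj₂ (parity-offset k))
    k+r-even : EvenAt k r
    k+r-even = proj₂ (proj₂ (parity-offset k))
    suc-n≡2m+1 : suc n ≡ 2 ℕ.* m ℕ.+ 1
    suc-n≡2m+1 = trans (cong suc (trans n≡m*2 (*-comm m 2))) (+-comm 1 (2 ℕ.* m))
    room-even : 2 ℕ.* m ℕ.+ r ≤ suc n
    room-even = subst (2 ℕ.* m ℕ.+ r ≤_) (sym suc-n≡2m+1) (+-monoʳ-≤ (2 ℕ.* m) r≤1)
    room-odd : r ℕ.+ n ≤ suc (2 ℕ.* m)
    room-odd = subst (r ℕ.+ n ≤_) (cong suc (trans n≡m*2 (*-comm m 2))) (+-monoˡ-≤ n r≤1)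
    open Count k+r-even {m} {m} room-even room-odd

  -- Its two cycle-neighbours are coprime to c, so by
  -- coprime-to-φ-multiple each is either the unique integer neighbour of c
  -- inside the range — impossible for both, as the cycle has length ≥ 3 — or
  -- forms an odd–odd edge with c, impossible for even n.
  endpoint-contradiction : 3 ≤ n → 2 ℕD.∣ n → (c : Fin n) → (toℕ c ≡ 0 ⊎ suc (toℕ c) ≡ n) →
    + φ n ∣ k + + toℕ c → ⊥
  endpoint-contradiction n≥3 n-even c c-end φ∣c = conclude (neighbour p₀ coprime₀) (neighbour p₁ coprime₁)
    where
    p p₀ p₁ : Fin n
    p = σ⁻¹ c
    p₁ = proj₁ (successor p)
    p₀ = proj₁ (predecessor p)
    p→p₁ : Succ n p p₁
    p→p₁ = proj₂ (successor p)
    p₀→p : Succ n p₀ p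
    p₀→p = proj₂ (predecessor p)

    Coprime-to-c : Fin n → Set
    Coprime-to-c v = gcd (k + + toℕ c) (k + + toℕ (σ v)) ≡ + 1

    coprime₁ : Coprime-to-c p₁
    coprime₁ = subst (λ v → gcd (k + + toℕ v) (k + + toℕ (σ p₁)) ≡ + 1) (σ∘σ⁻¹ c) (coprime-edge p→p₁)

    coprime₀ : Coprime-to-c p₀
    coprime₀ = subst (λ v → gcd (k + + toℕ v) (k + + toℕ (σ p₀)) ≡ + 1) (σ∘σ⁻¹ c)
      (trans (gcd-comm (k + + toℕ (σ p)) (k + + toℕ (σ p₀))) (coprime-edge p₀→p))

    Neighbour : Fin n → Set
    Neighbour v = Apart 1 (toℕ (σ v)) (toℕ c) ⊎ (¬ Even c × ¬ Even (σ v))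

    neighbour : ∀ v → Coprime-to-c v → Neighbour v
    neighbour v = coprime-to-φ-multiple k φ∣c (toℕ<n (σ v)) (toℕ<n c)

    odd-at-p : ¬ Even c → ¬ Even (σ p)
    odd-at-p = subst (λ v → ¬ Even v) (sym (σ∘σ⁻¹ c))

    conclude : Neighbour p₀ → Neighbour p₁ → ⊥
    conclude (inj₁ near₀) (inj₁ near₁) =
      Succ-no-2-cycle n≥3 p₀→p (subst (Succ n p) (sym p₀≡p₁) p→p₁)
      where
      p₀≡p₁ : p₀ ≡ p₁
      p₀≡p₁ = σ-injective (toℕ-injective
        (endpoint-neighbour-unique c-end (toℕ<n (σ p₀)) (toℕ<n (σ p₁)) near₀ near₁))
    conclude _ (inj₂ (odd-c , odd₁)) = even-order-no-odd-edge n-even p→p₁ (odd-at-p odd-c) odd₁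
    conclude (inj₂ (odd-c , odd₀)) _ = even-order-no-odd-edge n-even p₀→p odd₀ (odd-at-p odd-c)

theorem2p4 : (k : ℤ) (n : ℕ) → NonZero n →
    ((¬ (2 ℕD.∣ n) × (+ 2) ∣ k) ⊎ (2 ℕD.∣ n × ((+ φ n) ∣ k ⊎ (+ φ n) ∣ ((k + + n) - + 1)))) →
    ¬ Hamiltonian n (CPAdj k n)
theorem2p4 k n _ (inj₁ (n-odd , 2∣k)) (_ , σ , σ-bijective , adjacent) =
  odd-order-even-start n-odd 2∣k
  where open HamiltonianCycle k n σ σ-bijective adjacent
theorem2p4 k (suc n) _ (inj₂ (n-even , inj₁ φ∣k)) (n≥3 , σ , σ-bijective , adjacent) =
  endpoint-contradiction n≥3 n-even fzero (inj₁ refl) φ∣first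
  where
  open HamiltonianCycle k (suc n) σ σ-bijective adjacent
  φ∣first : + φ (suc n) ∣ k + + 0
  φ∣first = subst (+ φ (suc n) ∣_) (sym (ℤ.+-identityʳ k)) φ∣k
theorem2p4 k (suc n) _ (inj₂ (n-even , inj₂ φ∣k+n-1)) (n≥3 , σ , σ-bijective , adjacent) =
  endpoint-contradiction n≥3 n-even (fromℕ n) (inj₂ (cong suc (toℕ-fromℕ n))) φ∣last
  where
  open HamiltonianCycle k (suc n) σ σ-bijective adjacent
  drop-one : ∀ a b → (a + (+ 1 + b)) - + 1 ≡ a + b
  drop-one = ℤ-solve
  k+n-1≡last : (k + + suc n) - + 1 ≡ k + + toℕ (fromℕ n)
  k+n-1≡last = trans (cong (λ z → (k + z) - + 1) (ℤ.pos-+ 1 n))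
                     (trans (drop-one k (+ n)) (cong (λ z → k + + z) (sym (toℕ-fromℕ n))))
  φ∣last : + φ (suc n) ∣ k + + toℕ (fromℕ n)
  φ∣last = subst (+ φ (suc n) ∣_) k+n-1≡last φ∣k+n-1
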